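{- Let $G$ be a finite, simple, connected graph. Then $G$ admits a gap-vertex-labelling $(\pi, c_\pi)$ if and only if $G$ admits a gap-vertex-labelling $(\pi', c_{\pi'})$ such that $\pi'(u) \neq \pi'(v)$ for every pair of distinct vertices $u, v \in V(G)$.
   Context: All graphs are finite, simple and connected. For $k \in \mathbb{N}$ and $[k] = \{1, \ldots, k\}$, a gap-$[k]$-vertex-labelling of $G$ is a pair $(\pi, c_\pi)$ where $\pi : V(G) \to [k]$ and $c_\pi : V(G) \to \{0, 1, \ldots, k\}$ is a proper vertex colouring of $G$ (adjacent vertices get distinct colours) such that for every $v \in V(G)$: if $d(v) \ge 2$ then $c_\pi(v) = \max_{u \in N(v)} \pi(u) - \min_{u \in N(v)} \pi(u)$, and if $d(v) = 1$ then $c_\pi(v) = \pi(u)$ where $u$ is the unique neighbour of $v$. A gap-vertex-labelling is a gap-$[k]$-vertex-labelling for some $k \in \mathbb{N}$. -}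

module Defs where

open import Data.Nat using (ℕ; zero; suc; _≤_; _∸_; _⊔_; _⊓_)
open import Data.Fin using (Fin)
open import Data.Bool using (Bool; true; false; T)
open import Data.List using (List; []; _∷_; map; filter; length; allFin; foldr)
open import Data.Unit using (⊤)
open import Data.Product using (Σ; _×_; _,_; ∃)
open import Relation.Binary.PropositionalEquality using (_≡_)
open import Relation.Nullary using (¬_)
open import Relation.Nullary.Decidable using (T?)

record Graph (n : ℕ) : Set where
  field
    adj       : Fin n → Fin n → Bool
    adj-sym   : ∀ u v → adj u v ≡ adj v u
    adj-irrefl : ∀ v → adj v v ≡ false
open Graph public

Adj : ∀ {n} → Graph n → Fin n → Fin n → Set
Adj G u v = T (adj G u v)

data Reach {n} (G : Graph n) : Fin n → Fin n → Set where
  here : ∀ {v} → Reach G v v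
  step : ∀ {u w v} → Adj G u w → Reach G w v → Reach G u v

Connected : ∀ {n} → Graph n → Set
Connected G = ∀ u v → Reach G u v

N : ∀ {n} → Graph n → Fin n → List (Fin n)
N G v = filter (λ u → T? (adj G v u)) (allFin _)

deg : ∀ {n} → Graph n → Fin n → ℕ
deg G v = length (N G v)

maxL : ℕ → List ℕ → ℕ
maxL x []       = x
maxL x (y ∷ ys) = x ⊔ maxL y ys

minL : ℕ → List ℕ → ℕ
minL x []       = x
minL x (y ∷ ys) = x ⊓ minL y ys

-- the colour induced at v by π:
--   d(v) ≥ 2 : max_{u ∈ N(v)} π(u) − min_{u ∈ N(v)} π(u)
--   d(v) = 1 : π(u) for the unique neighbour u
-- d(v) = 0 : no constraint (only possible for the one-vertex graph)
InducedColour : ∀ {n} → Graph n → (Fin n → ℕ) → Fin n → ℕ → Set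
InducedColour G π v c with map π (N G v)
... | []           = ⊤
... | x ∷ []       = c ≡ x
... | x ∷ y ∷ ys   = c ≡ maxL x (y ∷ ys) ∸ minL x (y ∷ ys)

record GapLabelling {n} (G : Graph n) (k : ℕ) : Set where
  field
    π        : Fin n → ℕ
    c        : Fin n → ℕ
    π-range  : ∀ v → 1 ≤ π v × π v ≤ k
    c-range  : ∀ v → c v ≤ k
    c-proper : ∀ u v → Adj G u v → ¬ (c u ≡ c v)
    c-gap    : ∀ v → InducedColour G π v (c v)
open GapLabelling public

HasGapLabelling : ∀ {n} → Graph n → Set
HasGapLabelling G = Σ ℕ λ k → GapLabelling G k

HasInjectiveGapLabelling : ∀ {n} → Graph n → Set
HasInjectiveGapLabelling G =
  Σ ℕ λ k → Σ (GapLabelling G k) λ L → ∀ u v → ¬ (u ≡ v) → ¬ (π L u ≡ π L v)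

-- Scale the labels and break ties by the vertex index: π′(u) = π(u)·M + u with
-- M = 2n + 1.  Then π′ is injective, and since M exceeds every index, the extreme
-- values of π′ on a neighbourhood are read off lexicographically from those of π.
-- Hence each induced colour becomes c′(v) = c(v)·M + δ with −n < δ < n, i.e.
-- c′(v) + n = c(v)·M + e with 0 ≤ e < M, so c′ is proper because c is.
module Submission where

open import Defs
open import Data.Nat using (ℕ; suc; _+_; _*_; _∸_; _⊔_; _⊓_; _≤_; _<_; NonZero)
open import Data.Nat.Properties
open import Data.Nat.DivMod using (_%_; %-remove-+ˡ; m<n⇒m%n≡m)
open import Data.Nat.Divisibility using (n∣m*n)
open import Data.Fin using (Fin; toℕ)
open import Data.Fin.Properties using (toℕ<n; toℕ-injective)
open import Data.List using (List; []; _∷_; map)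
open import Data.Product using (_×_; _,_; ∃-syntax; proj₁; proj₂)
open import Data.Sum using (_⊎_; inj₁; inj₂)
open import Data.Unit using (tt)
open import Relation.Binary using (tri<; tri≈; tri>)
open import Relation.Binary.PropositionalEquality
open import Relation.Nullary using (¬_)

*+-injective : ∀ {M a b r s} .{{_ : NonZero M}} → r < M → s < M →
               a * M + r ≡ b * M + s → a ≡ b × r ≡ s
*+-injective {M} {a} {b} {r} {s} r<M s<M eq = a≡b , r≡s
  where
  open ≡-Reasoning
  r≡s : r ≡ s
  r≡s = begin
    r               ≡⟨ m<n⇒m%n≡m r<M ⟨
    r % M           ≡⟨ %-remove-+ˡ r (n∣m*n a) ⟨
    (a * M + r) % M ≡⟨ cong (_% M) eq ⟩
    (b * M + s) % M ≡⟨ %-remove-+ˡ s (n∣m*n b) ⟩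
    s % M           ≡⟨ m<n⇒m%n≡m s<M ⟩
    s               ∎
  a≡b : a ≡ b
  a≡b = *-cancelʳ-≡ a b M (+-cancelʳ-≡ r (a * M) (b * M) (trans eq (cong (b * M +_) (sym r≡s))))

*+-<-lex : ∀ {M a b r} s → r < M → a < b → a * M + r < b * M + s
*+-<-lex {M} {a} {b} {r} s r<M a<b = begin-strict
  a * M + r <⟨ +-monoʳ-< (a * M) r<M ⟩
  a * M + M ≡⟨ +-comm (a * M) M ⟩
  suc a * M ≤⟨ *-monoˡ-≤ M a<b ⟩
  b * M     ≤⟨ m≤m+n (b * M) s ⟩
  b * M + s ∎
  where open ≤-Reasoning

⊔-lex : ∀ {M} a b {r s} → r < M → s < M →
        ∃[ t ] (t ≡ r ⊎ t ≡ s) × (a * M + r) ⊔ (b * M + s) ≡ (a ⊔ b) * M + t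
⊔-lex {M} a b {r} {s} r<M s<M with <-cmp a b
... | tri< a<b _ _ = s , inj₂ refl ,
  trans (m≤n⇒m⊔n≡n (<⇒≤ (*+-<-lex s r<M a<b)))
        (cong (λ x → x * M + s) (sym (m≤n⇒m⊔n≡n (<⇒≤ a<b))))
... | tri> _ _ b<a = r , inj₁ refl ,
  trans (m≥n⇒m⊔n≡m (<⇒≤ (*+-<-lex r s<M b<a)))
        (cong (λ x → x * M + r) (sym (m≥n⇒m⊔n≡m (<⇒≤ b<a))))
... | tri≈ _ refl _ = r ⊔ s , ⊔-sel r s ,
  trans (sym (+-distribˡ-⊔ (a * M) r s)) (cong (λ x → x * M + (r ⊔ s)) (sym (⊔-idem a)))

⊓-lex : ∀ {M} a b {r s} → r < M → s < M →
        ∃[ t ] (t ≡ r ⊎ t ≡ s) × (a * M + r) ⊓ (b * M + s) ≡ (a ⊓ b) * M + t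
⊓-lex {M} a b {r} {s} r<M s<M with <-cmp a b
... | tri< a<b _ _ = r , inj₁ refl ,
  trans (m≤n⇒m⊓n≡m (<⇒≤ (*+-<-lex s r<M a<b)))
        (cong (λ x → x * M + r) (sym (m≤n⇒m⊓n≡m (<⇒≤ a<b))))
... | tri> _ _ b<a = s , inj₂ refl ,
  trans (m≥n⇒m⊓n≡n (<⇒≤ (*+-<-lex r s<M b<a)))
        (cong (λ x → x * M + s) (sym (m≥n⇒m⊓n≡n (<⇒≤ b<a))))
... | tri≈ _ refl _ = r ⊓ s , ⊓-sel r s ,
  trans (sym (+-distribˡ-⊓ (a * M) r s)) (cong (λ x → x * M + (r ⊓ s)) (sym (⊓-idem a)))

*+-∸-*+ : ∀ {M a b r s} B → b ≤ a → s ≤ B → b * M + s ≤ a * M + r →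
          (a * M + r) ∸ (b * M + s) + B ≡ (a ∸ b) * M + (r + (B ∸ s))
*+-∸-*+ {M} {a} {b} {r} {s} B b≤a s≤B le = begin
  (a * M + r) ∸ (b * M + s) + B   ≡⟨ cong (λ x → x ∸ (b * M + s) + B) split ⟩
  (b * M + x) ∸ (b * M + s) + B   ≡⟨ cong (_+ B) ([m+n]∸[m+o]≡n∸o (b * M) x s) ⟩
  x ∸ s + B                       ≡⟨ +-∸-comm B s≤x ⟨
  x + B ∸ s                       ≡⟨ +-∸-assoc x s≤B ⟩
  x + (B ∸ s)                     ≡⟨ +-assoc ((a ∸ b) * M) r (B ∸ s) ⟩
  (a ∸ b) * M + (r + (B ∸ s))     ∎
  where
  open ≡-Reasoning
  x : ℕ
  x = (a ∸ b) * M + r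
  split : a * M + r ≡ b * M + x
  split = begin
    a * M + r                  ≡⟨ cong (λ y → y * M + r) (m+[n∸m]≡n b≤a) ⟨
    (b + (a ∸ b)) * M + r      ≡⟨ cong (_+ r) (*-distribʳ-+ M b (a ∸ b)) ⟩
    b * M + (a ∸ b) * M + r    ≡⟨ +-assoc (b * M) ((a ∸ b) * M) r ⟩
    b * M + x                  ∎
  s≤x : s ≤ x
  s≤x = +-cancelˡ-≤ (b * M) s x (subst (b * M + s ≤_) split le)

∈₂-< : ∀ {t r s B} → t ≡ r ⊎ t ≡ s → r < B → s < B → t < B
∈₂-< (inj₁ refl) r<B _ = r<B
∈₂-< (inj₂ refl) _ s<B = s<B

minL≤maxL : ∀ x xs → minL x xs ≤ maxL x xs
minL≤maxL x []      = ≤-refl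
minL≤maxL x (_ ∷ _) = ≤-trans (m⊓n≤m x _) (m≤m⊔n x _)

-- The default d is the colour of an isolated vertex, which InducedColour leaves free.
gapColour : ℕ → List ℕ → ℕ
gapColour d []           = d
gapColour d (x ∷ [])     = x
gapColour d (x ∷ y ∷ ys) = maxL x (y ∷ ys) ∸ minL x (y ∷ ys)

gapColour-induced : ∀ {n} (G : Graph n) π v d →
                    InducedColour G π v (gapColour d (map π (N G v)))
gapColour-induced G π v d with map π (N G v)
... | []        = tt
... | _ ∷ []    = refl
... | _ ∷ _ ∷ _ = refl

induced⇒gapColour : ∀ {n} (G : Graph n) π v {c} →
                    InducedColour G π v c → c ≡ gapColour c (map π (N G v))
induced⇒gapColour G π v i with map π (N G v)
... | []        = refl
... | _ ∷ []    = i
... | _ ∷ _ ∷ _ = i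

module MixedRadix {a} {A : Set a} (g h : A → ℕ) {B M : ℕ}
                  (h<B : ∀ x → h x < B) (B+B<M : B + B < M) where

  lex : A → ℕ
  lex x = g x * M + h x

  B<M : B < M
  B<M = ≤-<-trans (m≤m+n B B) B+B<M

  h<M : ∀ x → h x < M
  h<M x = <-trans (h<B x) B<M

  maxL-lex : ∀ x xs → ∃[ t ] t < B × maxL (lex x) (map lex xs) ≡ maxL (g x) (map g xs) * M + t
  maxL-lex x []       = h x , h<B x , refl
  maxL-lex x (y ∷ ys) =
    let t , t<B , eq   = maxL-lex y ys
        u , u∈ , eq′ = ⊔-lex (g x) (maxL (g y) (map g ys)) (h<M x) (<-trans t<B B<M)
    in u , ∈₂-< u∈ (h<B x) t<B , trans (cong (lex x ⊔_) eq) eq′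

  minL-lex : ∀ x xs → ∃[ t ] t < B × minL (lex x) (map lex xs) ≡ minL (g x) (map g xs) * M + t
  minL-lex x []       = h x , h<B x , refl
  minL-lex x (y ∷ ys) =
    let t , t<B , eq   = minL-lex y ys
        u , u∈ , eq′ = ⊓-lex (g x) (minL (g y) (map g ys)) (h<M x) (<-trans t<B B<M)
    in u , ∈₂-< u∈ (h<B x) t<B , trans (cong (lex x ⊓_) eq) eq′

  gapColour-lex : ∀ d xs → ∃[ e ] e < M ×
                  gapColour (d * M) (map lex xs) + B ≡ gapColour d (map g xs) * M + e
  gapColour-lex d []       = B , B<M , refl
  gapColour-lex d (x ∷ []) =
    h x + B , <-trans (+-monoˡ-< B (h<B x)) B+B<M , +-assoc (g x * M) (h x) B
  gapColour-lex d (x ∷ y ∷ ys) =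
    let e₁ , e₁<B , max≡ = maxL-lex x (y ∷ ys)
        e₂ , e₂<B , min≡ = minL-lex x (y ∷ ys)
    in e₁ + (B ∸ e₂) ,
       <-trans (+-mono-<-≤ e₁<B (m∸n≤m B e₂)) B+B<M ,
       trans (cong (_+ B) (cong₂ _∸_ max≡ min≡))
             (*+-∸-*+ B (minL≤maxL (g x) (map g (y ∷ ys))) (<⇒≤ e₂<B)
                        (subst₂ _≤_ min≡ max≡ (minL≤maxL (lex x) (map lex (y ∷ ys)))))

module Separated {n} (G : Graph n) {k} (L : GapLabelling G k) where

  M : ℕ
  M = suc (n + n)

  open MixedRadix (π L) toℕ toℕ<n (n<1+n (n + n))

  c′ : Fin n → ℕ
  c′ v = gapColour (c L v * M) (map lex (N G v))

  c′-digits : ∀ v → ∃[ e ] e < M × c′ v + n ≡ c L v * M + e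
  c′-digits v =
    let e , e<M , eq = gapColour-lex (c L v) (N G v)
    in e , e<M , trans eq (cong (λ x → x * M + e) (sym (induced⇒gapColour G (π L) v (c-gap L v))))

  lex-range : ∀ v → 1 ≤ lex v × lex v ≤ k * M + M
  lex-range v =
    ≤-trans (proj₁ (π-range L v)) (≤-trans (m≤m*n (π L v) M) (m≤m+n _ _)) ,
    +-mono-≤ (*-monoˡ-≤ M (proj₂ (π-range L v))) (<⇒≤ (h<M v))

  c′-range : ∀ v → c′ v ≤ k * M + M
  c′-range v =
    let e , e<M , eq = c′-digits v
    in ≤-trans (m≤m+n (c′ v) n)
               (subst (_≤ k * M + M) (sym eq) (+-mono-≤ (*-monoˡ-≤ M (c-range L v)) (<⇒≤ e<M)))

  c′-proper : ∀ u v → Adj G u v → ¬ c′ u ≡ c′ v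
  c′-proper u v uv eq =
    let eᵤ , eᵤ<M , eqᵤ = c′-digits u
        eᵥ , eᵥ<M , eqᵥ = c′-digits v
    in c-proper L u v uv
         (proj₁ (*+-injective eᵤ<M eᵥ<M (trans (sym eqᵤ) (trans (cong (_+ n) eq) eqᵥ))))

  labelling : GapLabelling G (k * M + M)
  labelling = record
    { π        = lex
    ; c        = c′
    ; π-range  = lex-range
    ; c-range  = c′-range
    ; c-proper = c′-proper
    ; c-gap    = λ v → gapColour-induced G lex v (c L v * M)
    }

  lex-injective : ∀ u v → ¬ u ≡ v → ¬ lex u ≡ lex v
  lex-injective u v u≢v eq =
    u≢v (toℕ-injective (proj₂ (*+-injective {a = π L u} {b = π L v} (h<M u) (h<M v) eq)))

lemma1 : ∀ {n} (G : Graph n) → Connected G →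
    (HasGapLabelling G → HasInjectiveGapLabelling G) ×
    (HasInjectiveGapLabelling G → HasGapLabelling G)
lemma1 G _ =
  (λ { (k , L) → _ , Separated.labelling G L , Separated.lex-injective G L }) ,
  (λ { (k , L , _) → k , L })
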